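{- Let $P$ be an instance of the Generalized Minimum Manhattan Network problem whose intersection graph $\mathrm{IG}[P]$ has treewidth at most $\mathrm{tw}$, and let $N^*\in\mathrm{Opt}(P)$. Then every $N\in\mathrm{Feas}(P)$ satisfies $\|N\|\le(\mathrm{tw}+1)\cdot\|N^*\|$.
   Context: A Manhattan path (M-path) for $(s,t)$ is an $s$–$t$ path of axis-aligned segments of total length $|s_x-t_x|+|s_y-t_y|$. The Hanan grid $\mathcal{H}(P)$ is the grid network whose vertex set is $X\times Y$, where $X$ (resp. $Y$) is the set of all $x$- (resp. $y$-) coordinates of points appearing in pairs of $P$, with edges joining consecutive grid vertices. $\Pi_P(v)$ is the set of M-paths for $v$ that are subgraphs of $\mathcal{H}(P)$. $\mathrm{Feas}(P)=\prod_{v\in P}\Pi_P(v)$; a tuple $(\pi_v)_{v\in P}$ is identified with the network $\bigcup_{v}\pi_v$, and $\|N\|$ is its total edge length. $\mathrm{Opt}(P)$ is the set of $N\in\mathrm{Feas}(P)$ minimizing $\|N\|$. The bounding box $B(v)$ of $v=(p,q)$ is the axis-parallel rectangle with corners $p,q$; $\mathcal{H}(P,v)$ is the subgraph of $\mathcal{H}(P)$ induced by grid vertices in $B(v)$; $\mathrm{IG}[P]$ has vertex set $P$ with $u\ne v$ adjacent iff $\mathcal{H}(P,u),\mathcal{H}(P,v)$ share an edge.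
   Formalization: The points appearing in the pairs of the instance P have rational coordinates. -}

module Defs where

open import Level using (0ℓ)
open import Data.Nat as ℕ using (ℕ; zero; suc)
open import Data.Integer using (+_)
open import Data.Rational as ℚ using (ℚ; 0ℚ; _+_; _-_; ∣_∣; _⊓_; _⊔_; _≤_; _<_; _/_)
open import Data.Rational.Properties using (_≟_)
open import Data.Fin using (Fin; zero; suc; toℕ; inject₁)
open import Data.Fin.Subset using (Subset; _∈_) renaming (∣_∣ to size)
open import Data.List using (List; []; _∷_; _++_; map; concatMap; foldr; deduplicate)
open import Data.List.Membership.Propositional renaming (_∈_ to _∈ₗ_)
open import Data.List.Properties using ()
open import Data.Product using (Σ; ∃; ∃-syntax; _×_; _,_; proj₁; proj₂)
open import Data.Sum using (_⊎_; inj₁; inj₂)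
open import Relation.Nullary using (¬_; Dec; yes; no)
open import Relation.Nullary.Decidable using (_×-dec_; _⊎-dec_)
open import Relation.Binary.PropositionalEquality using (_≡_; _≢_)
open import Relation.Binary using (Rel)
import Relation.Binary as B

Point : Set
Point = ℚ × ℚ

xc yc : Point → ℚ
xc = proj₁
yc = proj₂

Pair : Set
Pair = Point × Point

dist : Point → Point → ℚ
dist a b = ∣ xc a - xc b ∣ + ∣ yc a - yc b ∣

-- An instance P of GMMN with n pairs is a family P : Fin n → Pair
-- (required to be injective in the theorem, so that P is a set of pairs).

module _ {n : ℕ} (P : Fin n → Pair) where

  private
    pts : List Point
    pts = concatMap (λ i → proj₁ (P i) ∷ proj₂ (P i) ∷ []) (Data.List.allFin n)
      where import Data.List

  Xs : List ℚ
  Xs = map xc pts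

  Ys : List ℚ
  Ys = map yc pts

  -- Directed description of a Hanan grid edge a → b with a the
  -- smaller endpoint: consecutive grid vertices on a horizontal or vertical line.
  HEdge : Point → Point → Set
  HEdge a b =
      (yc a ≡ yc b × yc a ∈ₗ Ys × xc a ∈ₗ Xs × xc b ∈ₗ Xs × xc a < xc b
         × (∀ z → z ∈ₗ Xs → ¬ (xc a < z × z < xc b)))
    ⊎ (xc a ≡ xc b × xc a ∈ₗ Xs × yc a ∈ₗ Ys × yc b ∈ₗ Ys × yc a < yc b
         × (∀ z → z ∈ₗ Ys → ¬ (yc a < z × z < yc b)))

  HAdj : Point → Point → Set
  HAdj a b = HEdge a b ⊎ HEdge b a

  data Walk : Point → Point → Set where
    []  : ∀ {a} → Walk a a
    _∷_ : ∀ {a b c} → HAdj a b → Walk b c → Walk a c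

  walkEdges : ∀ {a b} → Walk a b → List (Point × Point)
  walkEdges [] = []
  walkEdges (_∷_ {a} {b} _ w) = (a , b) ∷ walkEdges w

  walkLength : ∀ {a b} → Walk a b → ℚ
  walkLength [] = 0ℚ
  walkLength (_∷_ {a} {b} _ w) = dist a b + walkLength w

  -- Π_P(v): M-paths for v = (s , t) in H(P): an s–t path in H(P) of
  -- total length |s_x - t_x| + |s_y - t_y|.  (Such a walk is
  -- automatically a simple path, being monotone in both coordinates.)
  MPath : Pair → Set
  MPath (s , t) = Σ (Walk s t) (λ w → walkLength w ≡ dist s t)

  Feas : Set
  Feas = (i : Fin n) → MPath (P i)

  networkEdges : Feas → List (Point × Point)
  networkEdges N = concatMap (λ i → walkEdges (proj₁ (N i))) (Data.List.allFin n)
    where import Data.List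

SameEdge : Rel (Point × Point) 0ℓ
SameEdge (a , b) (c , d) = (a ≡ c × b ≡ d) ⊎ (a ≡ d × b ≡ c)

_≟P_ : B.DecidableEquality Point
(a₁ , a₂) ≟P (b₁ , b₂) with a₁ ≟ b₁ | a₂ ≟ b₂
... | yes Relation.Binary.PropositionalEquality.refl | yes Relation.Binary.PropositionalEquality.refl = yes Relation.Binary.PropositionalEquality.refl
... | no ne | _ = no (λ { Relation.Binary.PropositionalEquality.refl → ne Relation.Binary.PropositionalEquality.refl })
... | yes _ | no ne = no (λ { Relation.Binary.PropositionalEquality.refl → ne Relation.Binary.PropositionalEquality.refl })

sameEdge? : B.Decidable SameEdge
sameEdge? (a , b) (c , d) = ((a ≟P c) ×-dec (b ≟P d)) ⊎-dec ((a ≟P d) ×-dec (b ≟P c))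

sumℚ : List ℚ → ℚ
sumℚ = foldr _+_ 0ℚ

‖_‖ : ∀ {n} {P : Fin n → Pair} → Feas P → ℚ
‖_‖ {P = P} N = sumℚ (map (λ e → dist (proj₁ e) (proj₂ e))
                          (deduplicate sameEdge? (networkEdges P N)))

IsOpt : ∀ {n} (P : Fin n → Pair) → Feas P → Set
IsOpt P N* = ∀ (N : Feas P) → ‖ N* ‖ ≤ ‖ N ‖

InBox : Pair → Point → Set
InBox (p , q) a =
  (xc p ⊓ xc q ≤ xc a × xc a ≤ xc p ⊔ xc q) ×
  (yc p ⊓ yc q ≤ yc a × yc a ≤ yc p ⊔ yc q)

-- u ≠ v adjacent in IG[P] iff H(P,u) and H(P,v) share an edge, i.e. some
-- edge of H(P) has both endpoints in B(u) and in B(v).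
IGAdj : ∀ {n} (P : Fin n → Pair) → Fin n → Fin n → Set
IGAdj P u v =
  u ≢ v × ∃[ a ] ∃[ b ] (HAdj P a b × InBox (P u) a × InBox (P u) b
                                    × InBox (P v) a × InBox (P v) b)

-- A finite tree on node set Fin (suc m), given by parent pointers:
-- node (suc i) is joined to node (parent i), whose index is ≤ i.
-- Every finite tree is isomorphic to one of this form.
record Tree : Set where
  field
    m        : ℕ
    parent   : Fin m → Fin (suc m)
    parent<  : ∀ i → toℕ (parent i) ℕ.≤ toℕ i

  Node : Set
  Node = Fin (suc m)

  TAdj : Node → Node → Set
  TAdj a b = (∃[ i ] (a ≡ suc i × b ≡ parent i)) ⊎ (∃[ i ] (b ≡ suc i × a ≡ parent i))

  data WalkIn (S : Node → Set) : Node → Node → Set where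
    here : ∀ {a} → S a → WalkIn S a a
    step : ∀ {a b c} → S a → TAdj a b → WalkIn S b c → WalkIn S a c

record TreeDecomposition (n : ℕ) (Adj : Fin n → Fin n → Set) (k : ℕ) : Set where
  field
    tree      : Tree
  open Tree tree public
  field
    bag       : Node → Subset n
    -- width = max bag size − 1 ≤ k
    bagSize   : ∀ t → size (bag t) ℕ.≤ suc k
    covers    : ∀ v → ∃[ t ] (v ∈ bag t)
    edgeCover : ∀ u v → Adj u v → ∃[ t ] (u ∈ bag t × v ∈ bag t)
    connected : ∀ v t t′ → v ∈ bag t → v ∈ bag t′ → WalkIn (λ s → v ∈ bag s) t t′

TreewidthAtMost : (n : ℕ) → (Fin n → Fin n → Set) → ℕ → Set
TreewidthAtMost n Adj k = TreeDecomposition n Adj k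

ℕtoℚ : ℕ → ℚ
ℕtoℚ k = + k / 1

-- Every M-path for a pair v = (s , t) has length dist s t, so every feasible network N satisfies
-- ‖N‖ ≤ D, where D is the sum of dist s t over all pairs (the paths of N counted with multiplicity).
-- Conversely, in any feasible N* each grid edge is used by the paths of at most tw + 1 pairs: an M-path
-- stays in its bounding box and uses an edge at most once, so the pairs whose paths share an edge are
-- pairwise adjacent in IG[P], and by the Helly property of subtrees such a clique lies in a single bag.
-- Hence D ≤ (tw + 1) ‖N*‖.

module Submission where

open import Defs
open import Data.Nat using (ℕ; suc)
open import Data.Fin using (Fin)
open import Data.Rational using (_≤_; _*_)
open import Relation.Binary.PropositionalEquality using (_≡_)
open import Function.Definitions using (Injective)

open import Level using (0ℓ)
open import Algebra.Bundles using (Monoid)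
import Algebra.Properties.Monoid.Sum as MonoidSum
open import Data.Empty using (⊥; ⊥-elim)
open import Data.Fin using (zero; suc; toℕ)
import Data.Fin as Fin
import Data.Fin.Properties as FinP
open import Data.Fin.Subset using (Subset; inside; outside; _∉_) renaming (_∈_ to _∈ˢ_; ∣_∣ to size)
open import Data.Fin.Subset.Properties using (drop-there; _∈?_)
import Data.Integer as ℤ
import Data.Integer.Properties as ℤP
open import Data.List using (List; []; _∷_; _++_; map; filter; length; concatMap; tabulate; deduplicate)
import Data.List.Properties as ListP
open import Data.List.Relation.Unary.All as All using (All; []; _∷_)
open import Data.List.Relation.Unary.All.Properties using (all-filter; ¬Any⇒All¬) renaming (filter⁺ to All-filter⁺)
open import Data.List.Relation.Unary.Any using (Any; here; there; any?)
import Data.List.Relation.Binary.Sublist.Propositional.Properties as Sublist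
import Data.List.Membership.Setoid as SetoidMembership
open import Data.List.Membership.Setoid.Properties using (∈-deduplicate⁺)
open import Data.Nat as ℕ using (z≤n; s≤s)
import Data.Nat.Properties as ℕP
import Data.Nat.Coprimality as Coprimality
open import Data.Product using (∃-syntax; _×_; _,_; proj₁; proj₂)
open import Data.Rational as ℚ using (ℚ; 0ℚ; 1ℚ; mkℚ; _+_; _-_; -_; ∣_∣; _⊓_; _⊔_; _<_)
import Data.Rational.Properties as ℚP
open import Data.Rational.Solver using (module +-*-Solver)
open import Data.Vec using ([]; _∷_)
open import Data.Sum using (_⊎_; inj₁; inj₂; swap)
open import Function using (_∘_)
open import Relation.Binary using (TotalPreorder; DecSetoid; _Preserves_⟶_)
import Relation.Binary.Construct.Flip.EqAndOrd as Flip
open import Relation.Binary.PropositionalEquality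
  using (refl; sym; trans; cong; cong₂; subst; subst₂; _≢_; module ≡-Reasoning)
open import Relation.Nullary using (¬_; yes; no; ¬?)
open import Relation.Unary using (Pred; Decidable)

open +-*-Solver

module _ {c ℓ} (M : Monoid c ℓ) where
  open Monoid M using (Carrier; _≈_; _∙_; ε; ∙-congˡ) renaming (trans to ≈-trans)
  open MonoidSum M using (sum)

  hom-concatMap-tabulate : ∀ {A B : Set} (F : List A → Carrier) →
    F [] ≈ ε → (∀ xs ys → F (xs ++ ys) ≈ F xs ∙ F ys) →
    ∀ {m} (f : Fin m → B) (g : B → List A) →
    F (concatMap g (tabulate f)) ≈ sum (λ i → F (g (f i)))
  hom-concatMap-tabulate F F[] F-++ {ℕ.zero} f g = F[]
  hom-concatMap-tabulate F F[] F-++ {suc m} f g =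
    ≈-trans (F-++ (g (f zero)) _) (∙-congˡ (hom-concatMap-tabulate F F[] F-++ (f ∘ suc) g))

module ℚΣ = MonoidSum ℚP.+-0-monoid
module ℕΣ = MonoidSum ℕP.+-0-monoid

sum-≤-size : ∀ {m} (c : Fin m → ℕ) (s : Subset m) →
  (∀ i → c i ℕ.≤ 1) → (∀ i → i ∉ s → c i ≡ 0) → ℕΣ.sum c ℕ.≤ size s
sum-≤-size {ℕ.zero} c [] c≤1 c∉ = z≤n
sum-≤-size {suc m} c (inside ∷ s) c≤1 c∉ =
  ℕP.+-mono-≤ (c≤1 zero) (sum-≤-size (c ∘ suc) s (c≤1 ∘ suc) (λ i i∉s → c∉ (suc i) (i∉s ∘ drop-there)))
sum-≤-size {suc m} c (outside ∷ s) c≤1 c∉ rewrite c∉ zero (λ ()) =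
  sum-≤-size (c ∘ suc) s (c≤1 ∘ suc) (λ i i∉s → c∉ (suc i) (i∉s ∘ drop-there))

-- ℕtoℚ k = + k / 1 is stuck on a gcd for variable k; its normal form makes 1ℚ + ℕtoℚ k compute.
ℕtoℚ≡mkℚ : ∀ k → ℕtoℚ k ≡ mkℚ (ℤ.+ k) 0 (Coprimality.sym (Coprimality.1-coprimeTo k))
ℕtoℚ≡mkℚ k = ℚP.normalize-coprime (Coprimality.sym (Coprimality.1-coprimeTo k))

ℕtoℚ-suc : ∀ k → ℕtoℚ (suc k) ≡ 1ℚ + ℕtoℚ k
ℕtoℚ-suc k rewrite ℕtoℚ≡mkℚ k =
  sym (ℚP./-cong {p₁ = ℤ.+ 1 ℤ.* ℤ.+ 1 ℤ.+ ℤ.+ k ℤ.* ℤ.+ 1} {q₁ = 1} {p₂ = ℤ.+ suc k} {q₂ = 1}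
         (cong (ℤ._+_ (ℤ.+ 1)) (ℤP.*-identityʳ (ℤ.+ k))) refl)

ℕtoℚ-mono-≤ : ∀ {j k} → j ℕ.≤ k → ℕtoℚ j ≤ ℕtoℚ k
ℕtoℚ-mono-≤ {j} {k} j≤k rewrite ℕtoℚ≡mkℚ j | ℕtoℚ≡mkℚ k =
  ℚ.*≤* (subst₂ ℤ._≤_ (sym (ℤP.*-identityʳ (ℤ.+ j))) (sym (ℤP.*-identityʳ (ℤ.+ k))) (ℤ.+≤+ j≤k))

module Weighted (S : DecSetoid 0ℓ 0ℓ) (w : DecSetoid.Carrier S → ℚ)
                (w-resp : w Preserves DecSetoid._≈_ S ⟶ _≡_) (w-nonneg : ∀ x → 0ℚ ≤ w x) where
  open DecSetoid S using (Carrier; _≈_; _≟_; setoid) renaming (sym to ≈-sym; trans to ≈-trans)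
  open SetoidMembership setoid using () renaming (_∈_ to _∈ₛ_)

  weight : List Carrier → ℚ
  weight xs = sumℚ (map w xs)

  multiplicity : Carrier → List Carrier → ℕ
  multiplicity x xs = length (filter (x ≟_) xs)

  weight-++ : ∀ xs ys → weight (xs ++ ys) ≡ weight xs + weight ys
  weight-++ [] ys = sym (ℚP.+-identityˡ (weight ys))
  weight-++ (x ∷ xs) ys = trans (cong (w x +_) (weight-++ xs ys)) (sym (ℚP.+-assoc (w x) (weight xs) (weight ys)))

  weight-filter-≤ : ∀ {p} {P : Pred Carrier p} (P? : Decidable P) xs → weight (filter P? xs) ≤ weight xs
  weight-filter-≤ P? [] = ℚP.≤-refl
  weight-filter-≤ P? (x ∷ xs) with P? x
  ... | yes _ = ℚP.+-monoʳ-≤ (w x) (weight-filter-≤ P? xs)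
  ... | no _ = subst (_≤ w x + weight xs) (ℚP.+-identityˡ _) (ℚP.+-mono-≤ (w-nonneg x) (weight-filter-≤ P? xs))

  weight-deduplicate-≤ : ∀ xs → weight (deduplicate _≟_ xs) ≤ weight xs
  weight-deduplicate-≤ [] = ℚP.≤-refl
  weight-deduplicate-≤ (x ∷ xs) =
    ℚP.+-monoʳ-≤ (w x) (ℚP.≤-trans (weight-filter-≤ (¬? ∘ (x ≟_)) (deduplicate _≟_ xs)) (weight-deduplicate-≤ xs))

  weight-partition : ∀ {p} {P : Pred Carrier p} (P? : Decidable P) xs →
    weight xs ≡ weight (filter P? xs) + weight (filter (¬? ∘ P?) xs)
  weight-partition P? [] = refl
  weight-partition P? (x ∷ xs) with P? x
  ... | yes _ = trans (cong (w x +_) (weight-partition P? xs)) (sym (ℚP.+-assoc (w x) _ _))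
  ... | no _ = trans (cong (w x +_) (weight-partition P? xs))
                 (solve 3 (λ a b c → a :+ (b :+ c) := b :+ (a :+ c)) refl
                    (w x) (weight (filter P? xs)) (weight (filter (¬? ∘ P?) xs)))

  weight-const : ∀ {c} {ys} → All (λ y → w y ≡ c) ys → weight ys ≡ ℕtoℚ (length ys) * c
  weight-const {c} [] = sym (ℚP.*-zeroˡ c)
  weight-const {c} {y ∷ ys} (wy≡c ∷ ws≡c) = begin
    w y + weight ys                   ≡⟨ cong₂ _+_ wy≡c (weight-const ws≡c) ⟩
    c + ℕtoℚ (length ys) * c          ≡⟨ solve 2 (λ c k → c :+ k :* c := (con 1ℚ :+ k) :* c) refl c (ℕtoℚ (length ys)) ⟩
    (1ℚ + ℕtoℚ (length ys)) * c       ≡⟨ cong (_* c) (ℕtoℚ-suc (length ys)) ⟨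
    ℕtoℚ (length (y ∷ ys)) * c        ∎
    where open ≡-Reasoning

  multiplicity-filter-≤ : ∀ {p} {P : Pred Carrier p} (P? : Decidable P) x xs →
    multiplicity x (filter P? xs) ℕ.≤ multiplicity x xs
  multiplicity-filter-≤ P? x xs =
    Sublist.length-mono-≤ (Sublist.filter⁺ (x ≟_) (x ≟_) (λ { refl x≈a → x≈a }) (Sublist.filter-⊆ P? xs))

  weight-≤-covered : ∀ k ds {xs} → (∀ x → multiplicity x xs ℕ.≤ k) → All (_∈ₛ ds) xs →
    weight xs ≤ ℕtoℚ k * weight ds
  weight-≤-covered k [] {[]} _ _ = ℚP.≤-reflexive (sym (ℚP.*-zeroʳ (ℕtoℚ k)))
  weight-≤-covered k [] {_ ∷ _} _ (() ∷ _)
  weight-≤-covered k (d ∷ ds) {xs} mult≤k covered = begin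
    weight xs                                      ≡⟨ weight-partition (d ≟_) xs ⟩
    weight (filter (d ≟_) xs) + weight rest        ≡⟨ cong (_+ weight rest) (weight-const class-weight) ⟩
    ℕtoℚ (multiplicity d xs) * w d + weight rest   ≤⟨ ℚP.+-mono-≤ class-bound rest-bound ⟩
    ℕtoℚ k * w d + ℕtoℚ k * weight ds              ≡⟨ ℚP.*-distribˡ-+ (ℕtoℚ k) (w d) (weight ds) ⟨
    ℕtoℚ k * weight (d ∷ ds)                       ∎
    where
    open ℚP.≤-Reasoning
    rest : List Carrier
    rest = filter (¬? ∘ (d ≟_)) xs
    class-weight : All (λ y → w y ≡ w d) (filter (d ≟_) xs)
    class-weight = All.map (sym ∘ w-resp) (all-filter (d ≟_) xs)
    class-bound : ℕtoℚ (multiplicity d xs) * w d ≤ ℕtoℚ k * w d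
    class-bound = ℚP.*-monoʳ-≤-nonNeg (w d) {{ℚ.nonNegative (w-nonneg d)}} (ℕtoℚ-mono-≤ (mult≤k d))
    drop-class : ∀ {x} → x ∈ₛ d ∷ ds × ¬ d ≈ x → x ∈ₛ ds
    drop-class (here x≈d , d≉x) = ⊥-elim (d≉x (≈-sym x≈d))
    drop-class (there x∈ds , _) = x∈ds
    rest-bound : weight rest ≤ ℕtoℚ k * weight ds
    rest-bound = weight-≤-covered k ds (λ x → ℕP.≤-trans (multiplicity-filter-≤ (¬? ∘ (d ≟_)) x xs) (mult≤k x))
                   (All.zipWith drop-class (All-filter⁺ (¬? ∘ (d ≟_)) covered , all-filter (¬? ∘ (d ≟_)) xs))

  weight-≤-multiplicity*weight-deduplicate : ∀ k xs → (∀ x → multiplicity x xs ℕ.≤ k) →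
    weight xs ≤ ℕtoℚ k * weight (deduplicate _≟_ xs)
  weight-≤-multiplicity*weight-deduplicate k xs mult≤k =
    weight-≤-covered k (deduplicate _≟_ xs) mult≤k
      (All.tabulateₛ setoid (∈-deduplicate⁺ setoid _≟_ (λ b≈a x≈a → ≈-trans x≈a (≈-sym b≈a))))

module _ {c ℓ₁ ℓ₂} (O : TotalPreorder c ℓ₁ ℓ₂) where
  open TotalPreorder O using (Carrier; _≲_; total) renaming (refl to ≲-refl; trans to ≲-trans)

  optimum : ∀ {n p} {C : Pred (Fin n) p} → Decidable C → (h : Fin n → Carrier) →
    (∀ i → ¬ C i) ⊎ ∃[ v ] (C v × ∀ u → C u → h v ≲ h u)
  optimum {ℕ.zero} C? h = inj₁ λ ()
  optimum {suc n} C? h with optimum (C? ∘ suc) (h ∘ suc) | C? zero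
  ... | inj₁ none | no ¬c₀ = inj₁ λ { zero → ¬c₀ ; (suc i) → none i }
  ... | inj₁ none | yes c₀ = inj₂ (zero , c₀ , λ { zero _ → ≲-refl ; (suc u) cu → ⊥-elim (none u cu) })
  ... | inj₂ (v , cv , opt) | no ¬c₀ = inj₂ (suc v , cv , λ { zero c₀ → ⊥-elim (¬c₀ c₀) ; (suc u) cu → opt u cu })
  ... | inj₂ (v , cv , opt) | yes c₀ with total (h zero) (h (suc v))
  ...   | inj₁ h₀≲ = inj₂ (zero , c₀ , λ { zero _ → ≲-refl ; (suc u) cu → ≲-trans h₀≲ (opt u cu) })
  ...   | inj₂ ≲h₀ = inj₂ (suc v , cv , λ { zero _ → ≲h₀ ; (suc u) cu → opt u cu })

module _ (T : Tree) where
  open Tree T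

  data Ancestor (x : Node) : Node → Set where
    self  : Ancestor x x
    child : ∀ i → Ancestor x (parent i) → Ancestor x (suc i)

  ancestor-≤ : ∀ {a b} → Ancestor a b → toℕ a ℕ.≤ toℕ b
  ancestor-≤ self = ℕP.≤-refl
  ancestor-≤ (child i a) = ℕP.≤-trans (ancestor-≤ a) (ℕP.m≤n⇒m≤1+n (parent< i))

  ancestors-comparable : ∀ {a b t} → Ancestor a t → Ancestor b t → Ancestor a b ⊎ Ancestor b a
  ancestors-comparable self b = inj₂ b
  ancestors-comparable (child i a) self = inj₁ (child i a)
  ancestors-comparable (child i a) (child .i b) = ancestors-comparable a b

  walkIn-head : ∀ {S a b} → WalkIn S a b → S a
  walkIn-head (here s) = s
  walkIn-head (step s _ _) = s

  -- A walk inside S can only climb above r through a node of S of smaller index than r.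
  walkIn-stays-below : ∀ {S} r → (∀ z → S z → toℕ r ℕ.≤ toℕ z) →
    ∀ {x y} → WalkIn S x y → Ancestor r x → Ancestor r y
  walkIn-stays-below r r-min (here _) a = a
  walkIn-stays-below r r-min (step _ (inj₁ (i , refl , refl)) w) self =
    ⊥-elim (ℕP.<-irrefl refl (s≤s (ℕP.≤-trans (r-min _ (walkIn-head w)) (parent< i))))
  walkIn-stays-below r r-min (step _ (inj₁ (i , refl , refl)) w) (child .i a) = walkIn-stays-below r r-min w a
  walkIn-stays-below r r-min (step _ (inj₂ (i , refl , refl)) w) a = walkIn-stays-below r r-min w (child i a)

  walkIn-exits-through : ∀ {S x t y} → Ancestor x t → WalkIn S t y → ¬ Ancestor x y → S x
  walkIn-exits-through a (here _) ¬a = ⊥-elim (¬a a)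
  walkIn-exits-through self (step s _ _) ¬a = s
  walkIn-exits-through (child i a) (step _ (inj₁ (.i , refl , refl)) w) ¬a = walkIn-exits-through a w ¬a
  walkIn-exits-through {x = x} (child i a) (step _ (inj₂ (j , refl , pj≡si)) w) ¬a =
    walkIn-exits-through (child j (subst (Ancestor x) pj≡si (child i a))) w ¬a

module _ {n k} {Adj : Fin n → Fin n → Set} (TD : TreeDecomposition n Adj k) where
  open TreeDecomposition TD

  private
    lowest-bag : ∀ v → ∃[ r ] (v ∈ˢ bag r × ∀ t → v ∈ˢ bag t → toℕ r ℕ.≤ toℕ t)
    lowest-bag v with optimum ℕP.≤-totalPreorder (λ t → v ∈? bag t) toℕ
    ... | inj₁ none = ⊥-elim (none (proj₁ (covers v)) (proj₂ (covers v)))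
    ... | inj₂ r = r

  top : Fin n → Node
  top v = proj₁ (lowest-bag v)

  top∈bag : ∀ v → v ∈ˢ bag (top v)
  top∈bag v = proj₁ (proj₂ (lowest-bag v))

  top-ancestor : ∀ v t → v ∈ˢ bag t → Ancestor tree (top v) t
  top-ancestor v t v∈t =
    walkIn-stays-below tree (top v) (proj₂ (proj₂ (lowest-bag v))) (connected v (top v) t (top∈bag v) v∈t) self

  -- top u and top v are both ancestors of t, so the walk in u's subtree from t up to top u passes top v.
  shared-bag⇒∈top : ∀ u v t → u ∈ˢ bag t → v ∈ˢ bag t → toℕ (top u) ℕ.≤ toℕ (top v) → u ∈ˢ bag (top v)
  shared-bag⇒∈top u v t u∈t v∈t tu≤tv with ancestors-comparable tree (top-ancestor u t u∈t) (top-ancestor v t v∈t)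
  ... | inj₂ tv≼tu = subst (λ r → u ∈ˢ bag r) (FinP.toℕ-injective (ℕP.≤-antisym tu≤tv (ancestor-≤ tree tv≼tu))) (top∈bag u)
  ... | inj₁ tu≼tv with top u Fin.≟ top v
  ...   | yes tu≡tv = subst (λ r → u ∈ˢ bag r) tu≡tv (top∈bag u)
  ...   | no tu≢tv = walkIn-exits-through tree (top-ancestor v t v∈t) (connected u t (top u) u∈t (top∈bag u))
                       (λ tv≼tu → tu≢tv (FinP.toℕ-injective (ℕP.≤-antisym (ancestor-≤ tree tu≼tv) (ancestor-≤ tree tv≼tu))))

  clique⊆bag : ∀ {p} {C : Pred (Fin n) p} → Decidable C → (∀ u v → C u → C v → u ≢ v → Adj u v) →
    ∃[ t ] (∀ u → C u → u ∈ˢ bag t)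
  clique⊆bag {C = C} C? adj with optimum (Flip.totalPreorder ℕP.≤-totalPreorder) C? (toℕ ∘ top)
  ... | inj₁ none = zero , λ u cu → ⊥-elim (none u cu)
  ... | inj₂ (v , cv , deepest) = top v , in-top
    where
    in-top : ∀ u → C u → u ∈ˢ bag (top v)
    in-top u cu with u Fin.≟ v
    ... | yes refl = top∈bag v
    ... | no u≢v with edgeCover u v (adj u v cu cv u≢v)
    ...   | t , u∈t , v∈t = shared-bag⇒∈top u v t u∈t v∈t (deepest u cu)

∣x-y∣≡∣y-x∣ : ∀ x y → ∣ x - y ∣ ≡ ∣ y - x ∣
∣x-y∣≡∣y-x∣ x y = trans (sym (ℚP.∣-p∣≡∣p∣ (x - y))) (cong ∣_∣ (solve 2 (λ x y → :- (x :- y) := y :- x) refl x y))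

∣-x--y∣≡∣x-y∣ : ∀ x y → ∣ - x - - y ∣ ≡ ∣ x - y ∣
∣-x--y∣≡∣x-y∣ x y = trans (cong ∣_∣ (solve 2 (λ x y → :- x :- :- y := :- (x :- y)) refl x y)) (ℚP.∣-p∣≡∣p∣ (x - y))

∣x-z∣≤∣x-y∣+∣y-z∣ : ∀ x y z → ∣ x - z ∣ ≤ ∣ x - y ∣ + ∣ y - z ∣
∣x-z∣≤∣x-y∣+∣y-z∣ x y z =
  subst (λ d → ∣ d ∣ ≤ ∣ x - y ∣ + ∣ y - z ∣) (solve 3 (λ x y z → (x :- y) :+ (y :- z) := x :- z) refl x y z)
    (ℚP.∣p+q∣≤∣p∣+∣q∣ (x - y) (y - z))

x<y⇒0<y-x : ∀ {x y} → x < y → 0ℚ < y - x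
x<y⇒0<y-x {x} {y} x<y = subst (_< y - x) (ℚP.+-inverseʳ x) (ℚP.+-monoˡ-< (- x) x<y)

∣u-v∣<u+v : ∀ {u v} → 0ℚ < u → 0ℚ < v → ∣ u - v ∣ < u + v
∣u-v∣<u+v {u} {v} 0<u 0<v with ℚP.∣p∣≡p∨∣p∣≡-p (u - v)
... | inj₁ ∣u-v∣≡u-v = subst (_< u + v) (sym ∣u-v∣≡u-v) (ℚP.+-monoʳ-< u (ℚP.<-trans (ℚP.neg-antimono-< 0<v) 0<v))
... | inj₂ ∣u-v∣≡-[u-v] = subst (_< u + v) (sym (trans ∣u-v∣≡-[u-v] (solve 2 (λ u v → :- (u :- v) := :- u :+ v) refl u v)))
                         (ℚP.+-monoˡ-< v (ℚP.<-trans (ℚP.neg-antimono-< 0<u) 0<u))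

below-both⇒detour : ∀ {p q a} → a < p → a < q → ∣ p - q ∣ < ∣ p - a ∣ + ∣ a - q ∣
below-both⇒detour {p} {q} {a} a<p a<q =
  subst₂ _<_ (cong ∣_∣ (solve 3 (λ p q a → (p :- a) :- (q :- a) := p :- q) refl p q a))
    (cong₂ _+_ (sym (ℚP.0≤p⇒∣p∣≡p (ℚP.<⇒≤ 0<p-a))) (trans (sym (ℚP.0≤p⇒∣p∣≡p (ℚP.<⇒≤ 0<q-a))) (∣x-y∣≡∣y-x∣ q a)))
    (∣u-v∣<u+v 0<p-a 0<q-a)
  where
  0<p-a : 0ℚ < p - a
  0<p-a = x<y⇒0<y-x a<p
  0<q-a : 0ℚ < q - a
  0<q-a = x<y⇒0<y-x a<q

above-both⇒detour : ∀ {p q a} → p < a → q < a → ∣ p - q ∣ < ∣ p - a ∣ + ∣ a - q ∣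
above-both⇒detour {p} {q} {a} p<a q<a =
  subst₂ _<_ (∣-x--y∣≡∣x-y∣ p q) (cong₂ _+_ (∣-x--y∣≡∣x-y∣ p a) (∣-x--y∣≡∣x-y∣ a q))
    (below-both⇒detour (ℚP.neg-antimono-< p<a) (ℚP.neg-antimono-< q<a))

no-detour⇒between : ∀ p q a → ∣ p - a ∣ + ∣ a - q ∣ ≤ ∣ p - q ∣ → p ⊓ q ≤ a × a ≤ p ⊔ q
no-detour⇒between p q a no-detour =
    ℚP.≮⇒≥ (λ a<p⊓q → contradiction
      (below-both⇒detour (ℚP.<-≤-trans a<p⊓q (ℚP.p⊓q≤p p q)) (ℚP.<-≤-trans a<p⊓q (ℚP.p⊓q≤q p q))))
  , ℚP.≮⇒≥ (λ p⊔q<a → contradiction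
      (above-both⇒detour (ℚP.≤-<-trans (ℚP.p≤p⊔q p q) p⊔q<a) (ℚP.≤-<-trans (ℚP.p≤q⊔p p q) p⊔q<a)))
  where
  contradiction : ∣ p - q ∣ < ∣ p - a ∣ + ∣ a - q ∣ → ⊥
  contradiction detour = ℚP.<-irrefl refl (ℚP.<-≤-trans detour no-detour)

dist-sym : ∀ a b → dist a b ≡ dist b a
dist-sym a b = cong₂ _+_ (∣x-y∣≡∣y-x∣ (xc a) (xc b)) (∣x-y∣≡∣y-x∣ (yc a) (yc b))

dist-self : ∀ a → dist a a ≡ 0ℚ
dist-self a = cong₂ _+_ (∣x-x∣≡0 (xc a)) (∣x-x∣≡0 (yc a))
  where
  ∣x-x∣≡0 : ∀ x → ∣ x - x ∣ ≡ 0ℚ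
  ∣x-x∣≡0 x = cong ∣_∣ (ℚP.+-inverseʳ x)

dist-nonneg : ∀ a b → 0ℚ ≤ dist a b
dist-nonneg a b = ℚP.+-mono-≤ (ℚP.0≤∣p∣ (xc a - xc b)) (ℚP.0≤∣p∣ (yc a - yc b))

+-interchange : ∀ p q r s → (p + q) + (r + s) ≡ (p + r) + (q + s)
+-interchange = solve 4 (λ p q r s → (p :+ q) :+ (r :+ s) := (p :+ r) :+ (q :+ s)) refl

dist-triangle : ∀ a b c → dist a c ≤ dist a b + dist b c
dist-triangle a b c =
  subst (dist a c ≤_) (+-interchange (∣ xc a - xc b ∣) (∣ xc b - xc c ∣) (∣ yc a - yc b ∣) (∣ yc b - yc c ∣))
    (ℚP.+-mono-≤ (∣x-z∣≤∣x-y∣+∣y-z∣ (xc a) (xc b) (xc c)) (∣x-z∣≤∣x-y∣+∣y-z∣ (yc a) (yc b) (yc c)))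

-- A record rather than a synonym, so that s, x and t can be inferred from a proof of it.
record Between (s x t : Point) : Set where
  constructor between
  field
    tight : dist s x + dist x t ≤ dist s t

between-refl : ∀ s t → Between s s t
between-refl s t = between (ℚP.≤-reflexive (trans (cong (_+ dist s t) (dist-self s)) (ℚP.+-identityˡ (dist s t))))

between-trans : ∀ {s b x t} → Between s b t → Between b x t → Between s x t
between-trans {s} {b} {x} {t} (between sbt) (between bxt) = between (begin
  dist s x + dist x t                 ≤⟨ ℚP.+-monoˡ-≤ (dist x t) (dist-triangle s b x) ⟩
  (dist s b + dist b x) + dist x t    ≡⟨ ℚP.+-assoc (dist s b) (dist b x) (dist x t) ⟩
  dist s b + (dist b x + dist x t)    ≤⟨ ℚP.+-monoʳ-≤ (dist s b) bxt ⟩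
  dist s b + dist b t                 ≤⟨ sbt ⟩
  dist s t                            ∎)
  where open ℚP.≤-Reasoning

-- Adding the two betweenness inequalities gives 2·dist s b ≤ 0.
between-asym : ∀ {s b t} → 0ℚ < dist s b → Between s b t → ¬ Between b s t
between-asym {s} {b} {t} 0<sb (between sbt) (between bst) = ℚP.<-irrefl refl (begin-strict
  dist s t                                  ≡⟨ ℚP.+-identityˡ (dist s t) ⟨
  0ℚ + dist s t                             <⟨ ℚP.+-monoˡ-< (dist s t) (ℚP.+-mono-< 0<sb 0<sb) ⟩
  (dist s b + dist s b) + dist s t          ≡⟨ cong (λ d → (dist s b + d) + dist s t) (dist-sym s b) ⟩
  (dist s b + dist b s) + dist s t          ≡⟨ ℚP.+-assoc (dist s b) (dist b s) (dist s t) ⟩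
  dist s b + (dist b s + dist s t)          ≤⟨ ℚP.+-monoʳ-≤ (dist s b) bst ⟩
  dist s b + dist b t                       ≤⟨ sbt ⟩
  dist s t                                  ∎)
  where open ℚP.≤-Reasoning

+-cancelˡ-≤ : ∀ r {p q} → r + p ≤ r + q → p ≤ q
+-cancelˡ-≤ r {p} {q} r+p≤r+q = subst₂ _≤_ (cancel p) (cancel q) (ℚP.+-monoʳ-≤ (- r) r+p≤r+q)
  where
  cancel : ∀ x → - r + (r + x) ≡ x
  cancel x = solve 2 (λ r x → :- r :+ (r :+ x) := x) refl r x

tight-sum⇒≤ˡ : ∀ {p p′ q q′} → q ≤ q′ → p′ + q′ ≤ p + q → p′ ≤ p
tight-sum⇒≤ˡ {p} {p′} {q} {q′} q≤q′ sum≤ = +-cancelˡ-≤ q (begin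
  q + p′    ≡⟨ ℚP.+-comm q p′ ⟩
  p′ + q    ≤⟨ ℚP.+-monoʳ-≤ p′ q≤q′ ⟩
  p′ + q′   ≤⟨ sum≤ ⟩
  p + q     ≡⟨ ℚP.+-comm p q ⟩
  q + p     ∎)
  where open ℚP.≤-Reasoning

between⇒InBox : ∀ s t a → Between s a t → InBox (s , t) a
between⇒InBox s t a (between sat) =
    no-detour⇒between (xc s) (xc t) (xc a) (tight-sum⇒≤ˡ y-triangle sat′)
  , no-detour⇒between (yc s) (yc t) (yc a)
      (tight-sum⇒≤ˡ x-triangle (subst₂ _≤_ (ℚP.+-comm X Y) (ℚP.+-comm (∣ xc s - xc t ∣) (∣ yc s - yc t ∣)) sat′))
  where
  X Y : ℚ
  X = ∣ xc s - xc a ∣ + ∣ xc a - xc t ∣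
  Y = ∣ yc s - yc a ∣ + ∣ yc a - yc t ∣
  x-triangle : ∣ xc s - xc t ∣ ≤ X
  x-triangle = ∣x-z∣≤∣x-y∣+∣y-z∣ (xc s) (xc a) (xc t)
  y-triangle : ∣ yc s - yc t ∣ ≤ Y
  y-triangle = ∣x-z∣≤∣x-y∣+∣y-z∣ (yc s) (yc a) (yc t)
  sat′ : X + Y ≤ dist s t
  sat′ = subst (_≤ dist s t)
           (+-interchange (∣ xc s - xc a ∣) (∣ yc s - yc a ∣) (∣ xc a - xc t ∣) (∣ yc a - yc t ∣)) sat

Edge : Set
Edge = Point × Point

SameEdge-sym : ∀ {e e′} → SameEdge e e′ → SameEdge e′ e
SameEdge-sym (inj₁ (refl , refl)) = inj₁ (refl , refl)
SameEdge-sym (inj₂ (refl , refl)) = inj₂ (refl , refl)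

SameEdge-trans : ∀ {e e′ e″} → SameEdge e e′ → SameEdge e′ e″ → SameEdge e e″
SameEdge-trans (inj₁ (refl , refl)) e′≈e″ = e′≈e″
SameEdge-trans (inj₂ (refl , refl)) (inj₁ (refl , refl)) = inj₂ (refl , refl)
SameEdge-trans (inj₂ (refl , refl)) (inj₂ (refl , refl)) = inj₁ (refl , refl)

edgeDecSetoid : DecSetoid 0ℓ 0ℓ
edgeDecSetoid = record
  { Carrier = Edge
  ; _≈_ = SameEdge
  ; isDecEquivalence = record
    { isEquivalence = record { refl = inj₁ (refl , refl) ; sym = SameEdge-sym ; trans = SameEdge-trans }
    ; _≟_ = sameEdge?
    }
  }

edgeLength : Edge → ℚ
edgeLength e = dist (proj₁ e) (proj₂ e)

edgeLength-resp : ∀ {e e′} → SameEdge e e′ → edgeLength e ≡ edgeLength e′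
edgeLength-resp (inj₁ (refl , refl)) = refl
edgeLength-resp {a , b} (inj₂ (refl , refl)) = dist-sym a b

open Weighted edgeDecSetoid edgeLength edgeLength-resp (λ e → dist-nonneg (proj₁ e) (proj₂ e))

module _ {n} (P : Fin n → Pair) where

  private
    ∣x-y∣-pos : ∀ {x y} → x < y → 0ℚ < ∣ x - y ∣
    ∣x-y∣-pos {x} {y} x<y = subst (0ℚ <_) (trans (sym (ℚP.0≤p⇒∣p∣≡p (ℚP.<⇒≤ 0<y-x))) (∣x-y∣≡∣y-x∣ y x)) 0<y-x
      where
      0<y-x : 0ℚ < y - x
      0<y-x = x<y⇒0<y-x x<y

    x≤x+∣y∣ : ∀ x y → x ≤ x + ∣ y ∣
    x≤x+∣y∣ x y = subst (_≤ x + ∣ y ∣) (ℚP.+-identityʳ x) (ℚP.+-monoʳ-≤ x (ℚP.0≤∣p∣ y))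

    HEdge⇒0<dist : ∀ {a b} → HEdge P a b → 0ℚ < dist a b
    HEdge⇒0<dist {a} {b} (inj₁ (_ , _ , _ , _ , xa<xb , _)) =
      ℚP.<-≤-trans (∣x-y∣-pos xa<xb) (x≤x+∣y∣ (∣ xc a - xc b ∣) (yc a - yc b))
    HEdge⇒0<dist {a} {b} (inj₂ (_ , _ , _ , _ , ya<yb , _)) =
      ℚP.<-≤-trans (∣x-y∣-pos ya<yb)
        (subst (∣ yc a - yc b ∣ ≤_) (ℚP.+-comm (∣ yc a - yc b ∣) (∣ xc a - xc b ∣))
           (x≤x+∣y∣ (∣ yc a - yc b ∣) (xc a - xc b)))

  HAdj⇒0<dist : ∀ {a b} → HAdj P a b → 0ℚ < dist a b
  HAdj⇒0<dist (inj₁ ab) = HEdge⇒0<dist ab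
  HAdj⇒0<dist {a} {b} (inj₂ ba) = subst (0ℚ <_) (dist-sym b a) (HEdge⇒0<dist ba)

  dist≤walkLength : ∀ {s t} (w : Walk P s t) → dist s t ≤ walkLength P w
  dist≤walkLength {s} [] = ℚP.≤-reflexive (dist-self s)
  dist≤walkLength {s} {t} (_∷_ {b = b} _ w) =
    ℚP.≤-trans (dist-triangle s b t) (ℚP.+-monoʳ-≤ (dist s b) (dist≤walkLength w))

  Geodesic : ∀ {s t} → Walk P s t → Set
  Geodesic {s} {t} w = walkLength P w ≤ dist s t

  module _ {s b t} (adj : HAdj P s b) (w : Walk P b t) (geo : Geodesic (adj ∷ w)) where

    geodesic-head : Between s b t
    geodesic-head = between (ℚP.≤-trans (ℚP.+-monoʳ-≤ (dist s b) (dist≤walkLength w)) geo)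

    geodesic-tail : Geodesic w
    geodesic-tail = +-cancelˡ-≤ (dist s b) (ℚP.≤-trans geo (dist-triangle s b t))

  EdgeBetween : Point → Point → Edge → Set
  EdgeBetween s t e = HAdj P (proj₁ e) (proj₂ e) × Between s (proj₁ e) t × Between s (proj₂ e) t

  EdgeBetween-resp : ∀ {s t e e′} → SameEdge e e′ → EdgeBetween s t e → EdgeBetween s t e′
  EdgeBetween-resp (inj₁ (refl , refl)) eb = eb
  EdgeBetween-resp (inj₂ (refl , refl)) (adj , a-between , b-between) = swap adj , b-between , a-between

  EdgeBetween-narrow : ∀ {s b t e} → Between s b t → EdgeBetween b t e → EdgeBetween s t e
  EdgeBetween-narrow sbt (adj , bxt , byt) = adj , between-trans sbt bxt , between-trans sbt byt

  geodesic-edges-between : ∀ {s t} (w : Walk P s t) → Geodesic w → All (EdgeBetween s t) (walkEdges P w)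
  geodesic-edges-between [] _ = []
  geodesic-edges-between {s} {t} (adj ∷ w) geo =
    (adj , between-refl s t , geodesic-head adj w geo)
    ∷ All.map (EdgeBetween-narrow (geodesic-head adj w geo)) (geodesic-edges-between w (geodesic-tail adj w geo))

  geodesic-edge-between : ∀ {s t e} (w : Walk P s t) → Geodesic w →
    Any (SameEdge e) (walkEdges P w) → EdgeBetween s t e
  geodesic-edge-between w geo e∈w with All.lookupAny (geodesic-edges-between w geo) e∈w
  ... | eb , e≈e′ = EdgeBetween-resp (SameEdge-sym e≈e′) eb

  -- The first edge of a geodesic cannot recur: its source s would lie between b and t.
  geodesic-multiplicity-≤1 : ∀ {s t} (w : Walk P s t) → Geodesic w → ∀ e → multiplicity e (walkEdges P w) ℕ.≤ 1
  geodesic-multiplicity-≤1 [] _ e = z≤n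
  geodesic-multiplicity-≤1 {s} {t} (_∷_ {b = b} adj w) geo e with sameEdge? e (s , b)
  ... | no e≉sb = subst (ℕ._≤ 1) (cong length (sym (ListP.filter-reject (sameEdge? e) e≉sb)))
                    (geodesic-multiplicity-≤1 w (geodesic-tail adj w geo) e)
  ... | yes e≈sb = subst (ℕ._≤ 1) (cong length (sym (ListP.filter-accept (sameEdge? e) e≈sb)))
                     (s≤s (ℕP.≤-reflexive (cong length (ListP.filter-none (sameEdge? e) (All.map fresh tail-edges)))))
    where
    tail-edges : All (EdgeBetween b t) (walkEdges P w)
    tail-edges = geodesic-edges-between w (geodesic-tail adj w geo)
    fresh : ∀ {e′} → EdgeBetween b t e′ → ¬ SameEdge e e′
    fresh eb e≈e′ = between-asym (HAdj⇒0<dist adj) (geodesic-head adj w geo)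
      (proj₁ (proj₂ (EdgeBetween-resp (SameEdge-trans (SameEdge-sym e≈e′) e≈sb) eb)))

module _ {n} (P : Fin n → Pair) where

  pathEdges : Feas P → Fin n → List Edge
  pathEdges N i = walkEdges P (proj₁ (N i))

  demand : ℚ
  demand = ℚΣ.sum (λ i → dist (proj₁ (P i)) (proj₂ (P i)))

  weight-walkEdges : ∀ {s t} (w : Walk P s t) → weight (walkEdges P w) ≡ walkLength P w
  weight-walkEdges [] = refl
  weight-walkEdges (_∷_ {a} {b} _ w) = cong (dist a b +_) (weight-walkEdges w)

  weight-networkEdges : ∀ N → weight (networkEdges P N) ≡ demand
  weight-networkEdges N =
    trans (hom-concatMap-tabulate ℚP.+-0-monoid weight refl weight-++ (λ i → i) (pathEdges N))
          (ℚΣ.sum-cong-≗ (λ i → trans (weight-walkEdges (proj₁ (N i))) (proj₂ (N i))))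

  multiplicity-networkEdges : ∀ N e →
    multiplicity e (networkEdges P N) ≡ ℕΣ.sum (λ i → multiplicity e (pathEdges N i))
  multiplicity-networkEdges N e =
    hom-concatMap-tabulate ℕP.+-0-monoid (multiplicity e) refl
      (λ xs ys → trans (cong length (ListP.filter-++ (sameEdge? e) xs ys)) (ListP.length-++ (filter (sameEdge? e) xs)))
      (λ i → i) (pathEdges N)

  -- An edge used by the M-paths of u and of v lies in both bounding boxes.
  shared-edge⇒IGAdj : ∀ N e u v → Any (SameEdge e) (pathEdges N u) → Any (SameEdge e) (pathEdges N v) → u ≢ v →
    IGAdj P u v
  shared-edge⇒IGAdj N e u v e∈u e∈v u≢v
    with geodesic-edge-between P (proj₁ (N u)) (ℚP.≤-reflexive (proj₂ (N u))) e∈u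
       | geodesic-edge-between P (proj₁ (N v)) (ℚP.≤-reflexive (proj₂ (N v))) e∈v
  ... | adj , a-u , b-u | _ , a-v , b-v =
    u≢v , proj₁ e , proj₂ e , adj , between⇒InBox _ _ _ a-u , between⇒InBox _ _ _ b-u
                                   , between⇒InBox _ _ _ a-v , between⇒InBox _ _ _ b-v

  multiplicity-≤-treewidth : ∀ tw → TreewidthAtMost n (IGAdj P) tw →
    ∀ N e → multiplicity e (networkEdges P N) ℕ.≤ suc tw
  multiplicity-≤-treewidth tw TD N e = begin
    multiplicity e (networkEdges P N)              ≡⟨ multiplicity-networkEdges N e ⟩
    ℕΣ.sum (λ i → multiplicity e (pathEdges N i))  ≤⟨ sum-≤-size _ (bag t) at-most-once outside-unused ⟩
    size (bag t)                                   ≤⟨ bagSize t ⟩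
    suc tw                                         ∎
    where
    open ℕP.≤-Reasoning
    open TreeDecomposition TD using (bag; bagSize)
    users-in-bag : ∃[ t ] (∀ i → Any (SameEdge e) (pathEdges N i) → i ∈ˢ bag t)
    users-in-bag = clique⊆bag TD (λ i → any? (sameEdge? e) (pathEdges N i)) (shared-edge⇒IGAdj N e)
    t : Tree.Node (TreeDecomposition.tree TD)
    t = proj₁ users-in-bag
    at-most-once : ∀ i → multiplicity e (pathEdges N i) ℕ.≤ 1
    at-most-once i = geodesic-multiplicity-≤1 P (proj₁ (N i)) (ℚP.≤-reflexive (proj₂ (N i))) e
    outside-unused : ∀ i → i ∉ bag t → multiplicity e (pathEdges N i) ≡ 0
    outside-unused i i∉t = cong length (ListP.filter-none (sameEdge? e) (¬Any⇒All¬ _ (i∉t ∘ proj₂ users-in-bag i)))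

corollary3 : ∀ {n : ℕ} (P : Fin n → Pair) → Injective _≡_ _≡_ P →
    (tw : ℕ) → TreewidthAtMost n (IGAdj P) tw →
    (N* : Feas P) → IsOpt P N* →
    (N : Feas P) → ‖ N ‖ ≤ ℕtoℚ (suc tw) * ‖ N* ‖
corollary3 P _ tw TD N* _ N = begin
  ‖ N ‖                                ≤⟨ weight-deduplicate-≤ (networkEdges P N) ⟩
  weight (networkEdges P N)            ≡⟨ weight-networkEdges P N ⟩
  demand P                             ≡⟨ weight-networkEdges P N* ⟨
  weight (networkEdges P N*)           ≤⟨ weight-≤-multiplicity*weight-deduplicate (suc tw) (networkEdges P N*)
                                            (multiplicity-≤-treewidth P tw TD N*) ⟩
  ℕtoℚ (suc tw) * ‖ N* ‖               ∎
  where open ℚP.≤-Reasoning
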